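{- Let $p_i$ denote the $i$-th prime ($p_1=2$), and let $\alpha,k,m\in\mathbb{Z}^+$. Define \[t=\mathcal{T}\Big(\alpha,\Big[2^k\prod_{i=2}^{m}p_i^2\Big]\Big),\qquad t_{p_m}=\mathcal{T}\Big(\tfrac{\alpha}{p_m},\Big[2^k\prod_{i=2}^{m-1}p_i^2\Big]\Big),\] \[t_1=\mathcal{T}\Big(\alpha,\Big[2^{k-1}\prod_{i=2}^{m}p_i^2\Big]\Big),\qquad t_2=\mathcal{T}\Big(\tfrac{\alpha}{2},\Big[2^{k-1}\prod_{i=2}^{m}p_i^2\Big]\Big),\] where a product $\prod_{i=2}^{1}$ is defined to be $1$ and a product $\prod_{i=2}^{0}$ is defined to be $0$. Then $|t|\ge|t_{p_m}|+|t_1|+|t_2|$.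
   Context: $[n]=\{1,\dots,n\}$ (so $[0]=\emptyset$). $A+B$ is the Minkowski sum. For finite $C\subset\mathbb{Z}$ and $\alpha\in\mathbb{Z}^+$, $\mathcal{T}(\alpha,C)$ is the set of pairs $(A,B)$ of finite subsets of $\mathbb{Z}$ with $A+B=C$, $|C|=|A||B|$, $|A|=\alpha$, $0\in B$ and $\min B\ge0$. If $\alpha$ is not a positive integer, $\mathcal{T}(\alpha,C)=\emptyset$. -}

module Defs where

open import Data.Nat as ℕ using (ℕ; zero; suc; _^_; _*_; _<_)
open import Data.Integer as ℤ using (ℤ; +_)
open import Data.List using (List; length; map; upTo)
open import Data.List.Membership.Propositional using (_∈_)
open import Data.List.Relation.Unary.Linked using (Linked)
open import Data.List.Relation.Unary.Unique.Propositional using (Unique)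
open import Data.Product using (Σ; ∃; ∃₂; _×_; _,_)
open import Data.Nat.Primality using (Prime)
open import Relation.Binary.PropositionalEquality using (_≡_)
open import Function.Bundles using (_⇔_)

-- A finite subset of ℤ is represented canonically by a strictly increasing list.
IsFinSet : List ℤ → Set
IsFinSet = Linked ℤ._<_

interval : ℕ → List ℤ
interval n = map (λ i → + suc i) (upTo n)

SumsetEq : List ℤ → List ℤ → List ℤ → Set
SumsetEq A B C = ∀ z → z ∈ C ⇔ (∃₂ λ a b → a ∈ A × b ∈ B × z ≡ a ℤ.+ b)

-- Membership predicate of 𝒯(α/d, C) on pairs (A,B).  For general d, |A| * d = α says exactly that
-- |A| = α/d (and, as α ≥ 1 in the statement, α/d is then a positive integer;
-- if α/d is not a positive integer, no pair qualifies, i.e. 𝒯 = ∅).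
T : ℕ → ℕ → List ℤ → (List ℤ × List ℤ) → Set
T α d C (A , B) =
  IsFinSet A × IsFinSet B × IsFinSet C ×
  SumsetEq A B C ×
  length C ≡ length A * length B ×
  length A * d ≡ α ×
  (+ 0) ∈ B ×
  (∀ b → b ∈ B → + 0 ℤ.≤ b)

HasCard : {X : Set} → (X → Set) → ℕ → Set
HasCard {X} P k =
  Σ (List X) λ xs → Unique xs × (∀ x → P x ⇔ x ∈ xs) × length xs ≡ k

-- p enumerates the primes in increasing order, p 1 = 2, p 2 = 3, …
-- (the value p 0 is irrelevant).
IsPrimeSeq : (ℕ → ℕ) → Set
IsPrimeSeq p =
  (∀ i → Prime (p (suc i))) ×
  (∀ i → p (suc i) < p (suc (suc i))) ×
  (∀ q → Prime q → ∃ λ i → p (suc i) ≡ q)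

prodSq : (ℕ → ℕ) → ℕ → ℕ
prodSq p zero = 0
prodSq p (suc zero) = 1
prodSq p (suc (suc j)) = prodSq p (suc j) * (p (suc (suc j)) ^ 2)

-- Let h = 2^{k−1} ∏_{i=2}^{m} p_i², q = p_m and L = 2^k ∏_{i=2}^{m−1} p_i², so 2h = q²L.
-- Three maps send tilings into 𝒯(α, [2h]):
--   (A, B) ↦ (A, B ∪ (B + h))                                 on 𝒯(α, [h]),
--   (A, B) ↦ (A ∪ (A + h), B)                                 on 𝒯(α/2, [h]),
--   (A, B) ↦ (A + {0, L, …, (q−1)L}, B + {0, qL, …, (q−1)qL})   on 𝒯(α/q, [L]).
-- Each is injective, and the images are disjoint, as one sees on the B-parts: the first
-- contains h while in the second B ⊆ [0, h); the third contains (q−1)qL ≥ h, and it cannot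
-- contain h, since h = b + j·qL with 2b < qL would force q = 2j, but q is odd.
-- For m = 1 the third family is empty, its interval [0] being empty.

module Submission where

open import Defs
open import Data.Nat using (ℕ; _+_; _*_; _^_; _∸_; _≤_)
open import Data.Nat as ℕ using (zero; suc; _<_; _≮_; s≤s; z≤n)
import Data.Nat.Properties as ℕP
open import Data.Nat.DivMod
  using (_/_; _%_; m≡m%n+[m/n]*n; m%n<n; m<n*o⇒m/o<n; m<n⇒m/n≡0; m*n/n≡m; +-distrib-/-∣ʳ)
open import Data.Nat.Divisibility using (_∣_; divides)
open import Data.Nat.Primality using (Prime; prime⇒irreducible; prime⇒nonTrivial)
open import Data.Nat.Tactic.RingSolver using (solve-∀)
open import Data.Integer as ℤ using (ℤ; +_)
import Data.Integer.Properties as ℤP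
open import Algebra.Properties.CommutativeSemigroup ℤP.+-commutativeSemigroup using (xy∙z≈xz∙y)
open import Data.List using (List; []; _∷_; _++_; length; map; upTo)
import Data.List.Properties as LP
open import Data.List.Membership.Propositional using (_∈_)
open import Data.List.Membership.Propositional.Properties
  using (∈-∃++; ∈-++⁺ˡ; ∈-++⁺ʳ; ∈-++⁻; ∈-map⁺; ∈-map⁻; ∈-upTo⁺; ∈-upTo⁻)
open import Data.List.Relation.Binary.Subset.Propositional using (_⊆_)
open import Data.List.Relation.Binary.Disjoint.Propositional using (Disjoint)
open import Data.List.Relation.Unary.Any using (here; there)
open import Data.List.Relation.Unary.All as All using (All)
import Data.List.Relation.Unary.All.Properties as All
open import Data.List.Relation.Unary.AllPairs as AllPairs using (AllPairs; _∷_)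
import Data.List.Relation.Unary.AllPairs.Properties as AllPairs
import Data.List.Relation.Unary.Linked.Properties as Linked
open import Data.List.Relation.Unary.Unique.Propositional using (Unique)
import Data.List.Relation.Unary.Unique.Propositional.Properties as Unique
open import Data.Product using (∃-syntax; ∃₂; _×_; _,_; proj₁; proj₂)
open import Data.Sum using (_⊎_; inj₁; inj₂; [_,_]′)
open import Data.Sum.Properties using (inj₁-injective; inj₂-injective)
open import Data.Empty using (⊥-elim)
open import Function using (_∘_; case_of_)
open import Function.Bundles using (_⇔_; mk⇔; Equivalence)
open import Relation.Nullary using (¬_)
open import Relation.Binary.PropositionalEquality

open Equivalence using (to; from)

private
  variable
    X Y : Set
    α d h n q r s L : ℕ
    A B : List ℤ

Unique∧⊆⇒length≤ : {xs ys : List X} → Unique xs → xs ⊆ ys → length xs ≤ length ys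
Unique∧⊆⇒length≤ {xs = []} _ _ = z≤n
Unique∧⊆⇒length≤ {xs = x ∷ xs} (x∉xs ∷ xs!) xs⊆ys
  with pre , post , refl ← ∈-∃++ (xs⊆ys (here refl)) =
  subst (suc (length xs) ≤_) (sym (LP.length-++-sucʳ pre x post))
    (s≤s (Unique∧⊆⇒length≤ xs! xs⊆pre++post))
  where
  xs⊆pre++post : xs ⊆ pre ++ post
  xs⊆pre++post {z} z∈xs with ∈-++⁻ pre (xs⊆ys (there z∈xs))
  ... | inj₁ z∈pre           = ∈-++⁺ˡ z∈pre
  ... | inj₂ (here refl)     = ⊥-elim (All.lookup x∉xs z∈xs refl)
  ... | inj₂ (there z∈post)  = ∈-++⁺ʳ pre z∈post

Unique-map⁺-injectiveOn : {f : X → Y} {xs : List X} →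
                          (∀ {x y} → x ∈ xs → y ∈ xs → f x ≡ f y → x ≡ y) →
                          Unique xs → Unique (map f xs)
Unique-map⁺-injectiveOn {xs = []} _ _ = AllPairs.[]
Unique-map⁺-injectiveOn {xs = x ∷ xs} f-inj (x∉xs ∷ xs!) =
  All.map⁺ (All.tabulate λ y∈xs fx≡fy →
              All.lookup x∉xs y∈xs (f-inj (here refl) (there y∈xs) fx≡fy))
  ∷ Unique-map⁺-injectiveOn (λ x∈ y∈ → f-inj (there x∈) (there y∈)) xs!

HasCard-≤ : {P : X → Set} {Q : Y → Set} {m n : ℕ} (f : X → Y) →
            (∀ {x} → P x → Q (f x)) → (∀ {x y} → P x → P y → f x ≡ f y → x ≡ y) →
            HasCard P m → HasCard Q n → m ≤ n
HasCard-≤ f f-maps f-inj (xs , xs! , P⇔ , refl) (ys , _ , Q⇔ , refl) =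
  subst (_≤ length ys) (LP.length-map f xs) (Unique∧⊆⇒length≤ fxs! fxs⊆ys)
  where
  fxs! : Unique (map f xs)
  fxs! = Unique-map⁺-injectiveOn (λ x∈ y∈ → f-inj (from (P⇔ _) x∈) (from (P⇔ _) y∈)) xs!

  fxs⊆ys : map f xs ⊆ ys
  fxs⊆ys z∈ with x , x∈xs , refl ← ∈-map⁻ f z∈ = to (Q⇔ _) (f-maps (from (P⇔ x) x∈xs))

HasCard-⊎ : {P : X → Set} {Q : Y → Set} {m n : ℕ} →
            HasCard P m → HasCard Q n → HasCard [ P , Q ]′ (m + n)
HasCard-⊎ {P = P} {Q} (xs , xs! , P⇔ , refl) (ys , ys! , Q⇔ , refl) =
  zs , zs! , P⊎Q⇔ , length-zs
  where
  zs : List (_ ⊎ _)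
  zs = map inj₁ xs ++ map inj₂ ys

  zs! : Unique zs
  zs! = Unique.++⁺ (Unique.map⁺ inj₁-injective xs!) (Unique.map⁺ inj₂-injective ys!)
          disjoint
    where
    disjoint : Disjoint (map inj₁ xs) (map inj₂ ys)
    disjoint (l , r) with _ , _ , refl ← ∈-map⁻ inj₁ l | _ , _ , () ← ∈-map⁻ inj₂ r

  P⊎Q⇔ : ∀ z → [ P , Q ]′ z ⇔ z ∈ zs
  P⊎Q⇔ (inj₁ x) = mk⇔ (∈-++⁺ˡ ∘ ∈-map⁺ inj₁ ∘ to (P⇔ x)) (from (P⇔ x) ∘ inj₁⁻)
    where
    inj₁⁻ : inj₁ x ∈ zs → x ∈ xs
    inj₁⁻ x∈ with ∈-++⁻ (map inj₁ xs) x∈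
    ... | inj₁ l with _ , x′∈ , refl ← ∈-map⁻ inj₁ l = x′∈
    inj₁⁻ x∈ | inj₂ r with _ , _ , () ← ∈-map⁻ inj₂ r
  P⊎Q⇔ (inj₂ y) =
    mk⇔ (∈-++⁺ʳ (map inj₁ xs) ∘ ∈-map⁺ inj₂ ∘ to (Q⇔ y)) (from (Q⇔ y) ∘ inj₂⁻)
    where
    inj₂⁻ : inj₂ y ∈ zs → y ∈ ys
    inj₂⁻ y∈ with ∈-++⁻ (map inj₁ xs) y∈
    ... | inj₂ r with _ , y′∈ , refl ← ∈-map⁻ inj₂ r = y′∈
    inj₂⁻ y∈ | inj₁ l with _ , _ , () ← ∈-map⁻ inj₁ l

  length-zs : length zs ≡ length xs + length ys
  length-zs = trans (LP.length-++ (map inj₁ xs))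
                    (cong₂ _+_ (LP.length-map inj₁ xs) (LP.length-map inj₂ ys))

∈-interval⁻ : ∀ {z} → z ∈ interval n → ∃[ i ] i < n × z ≡ + suc i
∈-interval⁻ z∈ with i , i∈ , refl ← ∈-map⁻ _ z∈ = i , ∈-upTo⁻ i∈ , refl

∈-interval⁺ : ∀ {i} → i < n → + suc i ∈ interval n
∈-interval⁺ i<n = ∈-map⁺ _ (∈-upTo⁺ i<n)

length-interval : ∀ n → length (interval n) ≡ n
length-interval n = trans (LP.length-map _ (upTo n)) (LP.length-upTo n)

interval-sorted : ∀ n → IsFinSet (interval n)
interval-sorted n = subst IsFinSet (sym (LP.map-upTo _ n))
  (Linked.applyUpTo⁺₁ _ n λ _ → ℤ.+<+ (ℕP.n<1+n _))

∈-interval-*⁻ : ∀ r n {z} → z ∈ interval (r * n) →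
                ∃[ j ] j < r × ∃[ z₀ ] z₀ ∈ interval n × z ≡ z₀ ℤ.+ + (j * n)
∈-interval-*⁻ r zero z∈ with i , i<r*0 , _ ← ∈-interval⁻ {r * 0} z∈ =
  ⊥-elim (ℕP.n≮0 (subst (i <_) (ℕP.*-zeroʳ r) i<r*0))
∈-interval-*⁻ r n@(suc _) z∈ with i , i<r*n , refl ← ∈-interval⁻ z∈ =
  i / n , m<n*o⇒m/o<n i<r*n , + suc (i % n) , ∈-interval⁺ (m%n<n i n) ,
  cong (+_ ∘ suc) (m≡m%n+[m/n]*n i n)

∈-interval-*⁺ : ∀ {z₀ j} → z₀ ∈ interval n → j < r → z₀ ℤ.+ + (j * n) ∈ interval (r * n)
∈-interval-*⁺ {n} {r} {j = j} z₀∈ j<r with i , i<n , refl ← ∈-interval⁻ z₀∈ =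
  ∈-interval⁺ (ℕP.<-≤-trans (ℕP.+-monoˡ-< (j * n) i<n) (ℕP.*-monoˡ-≤ n j<r))

translates : List ℤ → ℕ → ℕ → List ℤ
translates X s zero    = []
translates X s (suc r) = X ++ map (ℤ._+ + s) (translates X s r)

+-shift-step : ∀ x j s → (x ℤ.+ + (j * s)) ℤ.+ + s ≡ x ℤ.+ + (suc j * s)
+-shift-step x j s = trans (ℤP.+-assoc x _ _) (cong (λ t → x ℤ.+ + t) (ℕP.+-comm (j * s) s))

∈-translates⁻ : ∀ {X y} → y ∈ translates X s r →
                ∃[ j ] j < r × ∃[ x ] x ∈ X × y ≡ x ℤ.+ + (j * s)
∈-translates⁻ {s} {suc r} {X} y∈ with ∈-++⁻ X y∈
... | inj₁ y∈X = 0 , s≤s z≤n , _ , y∈X , sym (ℤP.+-identityʳ _)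
... | inj₂ y∈ with w , w∈ , refl ← ∈-map⁻ _ y∈
              with j , j<r , x , x∈X , refl ← ∈-translates⁻ {s} {r} w∈ =
  suc j , s≤s j<r , x , x∈X , +-shift-step x j s

∈-translates⁺ : ∀ {X x j} → j < r → x ∈ X → x ℤ.+ + (j * s) ∈ translates X s r
∈-translates⁺ {suc r} {j = zero} _ x∈X =
  ∈-++⁺ˡ (subst (_∈ _) (sym (ℤP.+-identityʳ _)) x∈X)
∈-translates⁺ {suc r} {s} {X} {x} {suc j} (s≤s j<r) x∈X =
  ∈-++⁺ʳ X (subst (_∈ _) (+-shift-step x j s) (∈-map⁺ _ (∈-translates⁺ j<r x∈X)))

length-translates : ∀ X s r → length (translates X s r) ≡ r * length X
length-translates X s zero    = refl
length-translates X s (suc r) = trans (LP.length-++ X)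
  (cong (_+_ (length X)) (trans (LP.length-map _ (translates X s r)) (length-translates X s r)))

length-translates-*1 : ∀ X s r → length (translates X s r) * 1 ≡ length X * r
length-translates-*1 X s r =
  trans (ℕP.*-identityʳ _) (trans (length-translates X s r) (ℕP.*-comm r (length X)))

translates-sorted : ∀ {X} r lo → AllPairs ℤ._<_ X →
                    (∀ {x} → x ∈ X → lo ℤ.≤ x × x ℤ.< lo ℤ.+ + s) →
                    AllPairs ℤ._<_ (translates X s r)
translates-sorted zero    lo _ _ = AllPairs.[]
translates-sorted {s} {X} (suc r) lo X-sorted X-bounded =
  AllPairs.++⁺ X-sorted
    (AllPairs.map⁺ (AllPairs.map (ℤP.+-monoˡ-< (+ s)) (translates-sorted r lo X-sorted X-bounded)))
    (All.tabulate λ x∈X → All.tabulate λ y∈ → x<shifted x∈X y∈)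
  where
  x<shifted : ∀ {x y} → x ∈ X → y ∈ map (ℤ._+ + s) (translates X s r) → x ℤ.< y
  x<shifted x∈X y∈ with w , w∈ , refl ← ∈-map⁻ _ y∈
                   with _ , _ , x′ , x′∈X , refl ← ∈-translates⁻ {s} {r} w∈ =
    ℤP.<-≤-trans (proj₂ (X-bounded x∈X))
      (ℤP.+-monoˡ-≤ (+ s) (ℤP.≤-trans (proj₁ (X-bounded x′∈X)) (ℤP.i≤i+j x′ _)))

++-cancelʳ-sameLength : {xs ys us vs : List X} →
                        length xs ≡ length ys → xs ++ us ≡ ys ++ vs → xs ≡ ys
++-cancelʳ-sameLength {xs = []}     {[]}     _   _  = refl
++-cancelʳ-sameLength {xs = x ∷ xs} {y ∷ ys} |xs|≡|ys| eq with refl , eq′ ← LP.∷-injective eq =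
  cong (x ∷_) (++-cancelʳ-sameLength (ℕP.suc-injective |xs|≡|ys|) eq′)

translates-injective : ∀ {X Y} → 0 < r → translates X s r ≡ translates Y s r → X ≡ Y
translates-injective {suc r} {s} {X} {Y} _ eq = ++-cancelʳ-sameLength |X|≡|Y| eq
  where
  |X|≡|Y| : length X ≡ length Y
  |X|≡|Y| = ℕP.*-cancelˡ-≡ (length X) (length Y) (suc r)
    (trans (sym (length-translates X s (suc r)))
           (trans (cong length eq) (length-translates Y s (suc r))))

record Tiling (A B : List ℤ) (n : ℕ) : Set where
  field
    A-sorted : AllPairs ℤ._<_ A
    B-sorted : AllPairs ℤ._<_ B
    sumset   : SumsetEq A B (interval n)
    card     : n ≡ length A * length B
    0∈B      : + 0 ∈ B
    B-nonneg : ∀ {b} → b ∈ B → + 0 ℤ.≤ b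

  A⊆interval : A ⊆ interval n
  A⊆interval {a} a∈A =
    subst (_∈ interval n) (ℤP.+-identityʳ a) (from (sumset _) (a , + 0 , a∈A , 0∈B , refl))

  B-below : ∀ {a b} → a ∈ A → b ∈ B → ∃[ i ] i < n × b ≡ + i
  B-below {a} {b} a∈A b∈B with B-nonneg b∈B
  ... | ℤ.+≤+ {n = i} _
    with _ , _ , refl ← ∈-interval⁻ (A⊆interval a∈A)
    with _ , i′<n , a+b≡ ← ∈-interval⁻ (from (sumset (a ℤ.+ b)) (a , b , a∈A , b∈B , refl)) =
    i , ℕP.≤-<-trans (ℕP.m≤n+m i _) (subst (_< n) (sym (ℕP.suc-injective (ℤP.+-injective a+b≡))) i′<n)
      , refl

SumsetEq-comm : ∀ {C} → SumsetEq A B C → SumsetEq B A C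
SumsetEq-comm A+B=C z = mk⇔
  (λ z∈C → case to (A+B=C z) z∈C of λ (a , b , a∈ , b∈ , eq) →
             b , a , b∈ , a∈ , trans eq (ℤP.+-comm a b))
  (λ (b , a , b∈ , a∈ , eq) → from (A+B=C z) (a , b , a∈ , b∈ , trans eq (ℤP.+-comm b a)))

SumsetEq-translates : ∀ r → SumsetEq A B (interval n) →
                      SumsetEq (translates A n r) B (interval (r * n))
SumsetEq-translates {A} {B} {n} r A+B=[n] z = mk⇔ split join
  where
  split : z ∈ interval (r * n) → ∃₂ λ a b → a ∈ translates A n r × b ∈ B × z ≡ a ℤ.+ b
  split z∈ with j , j<r , z₀ , z₀∈ , refl ← ∈-interval-*⁻ r n z∈
           with a , b , a∈ , b∈ , refl ← to (A+B=[n] z₀) z₀∈ =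
    a ℤ.+ + (j * n) , b , ∈-translates⁺ j<r a∈ , b∈ , xy∙z≈xz∙y a b _

  join : (∃₂ λ a b → a ∈ translates A n r × b ∈ B × z ≡ a ℤ.+ b) → z ∈ interval (r * n)
  join (_ , b , a′∈ , b∈ , refl) with j , j<r , a , a∈ , refl ← ∈-translates⁻ {n} {r} a′∈ =
    subst (_∈ interval (r * n)) (xy∙z≈xz∙y a b _)
      (∈-interval-*⁺ (from (A+B=[n] (a ℤ.+ b)) (a , b , a∈ , b∈ , refl)) j<r)

Tiling-translatesˡ : ∀ r → Tiling A B n → Tiling (translates A n r) B (r * n)
Tiling-translatesˡ {A} {B} {n} r t = record
  { A-sorted = translates-sorted r (+ 1) A-sorted A-bounded
  ; B-sorted = B-sorted
  ; sumset   = SumsetEq-translates r sumset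
  ; card     = trans (cong (r *_) card) (trans (sym (ℕP.*-assoc r _ _))
                 (cong (_* length B) (sym (length-translates A n r))))
  ; 0∈B      = 0∈B
  ; B-nonneg = B-nonneg
  }
  where
  open Tiling t
  A-bounded : ∀ {a} → a ∈ A → + 1 ℤ.≤ a × a ℤ.< + 1 ℤ.+ + n
  A-bounded a∈A with _ , i<n , refl ← ∈-interval⁻ (A⊆interval a∈A) =
    ℤ.+≤+ (s≤s z≤n) , ℤ.+<+ (s≤s i<n)

Tiling-translatesʳ : ∀ r {a} → Tiling A B n → a ∈ A →
                     Tiling A (translates B n (suc r)) (suc r * n)
Tiling-translatesʳ {A} {B} {n} r t a∈A = record
  { A-sorted = A-sorted
  ; B-sorted = translates-sorted (suc r) (+ 0) B-sorted B-bounded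
  ; sumset   = SumsetEq-comm (SumsetEq-translates (suc r) (SumsetEq-comm sumset))
  ; card     = trans (cong (suc r *_) card) (trans (reorder r (length A) (length B))
                 (cong (length A *_) (sym (length-translates B n (suc r)))))
  ; 0∈B      = ∈-++⁺ˡ 0∈B
  ; B-nonneg = translates-nonneg
  }
  where
  open Tiling t
  reorder : ∀ r a b → suc r * (a * b) ≡ a * (suc r * b)
  reorder = solve-∀
  B-bounded : ∀ {b} → b ∈ B → + 0 ℤ.≤ b × b ℤ.< + 0 ℤ.+ + n
  B-bounded b∈B with _ , i<n , refl ← B-below a∈A b∈B = ℤ.+≤+ z≤n , ℤ.+<+ i<n
  translates-nonneg : ∀ {y} → y ∈ translates B n (suc r) → + 0 ℤ.≤ y
  translates-nonneg y∈ with _ , _ , b , b∈B , refl ← ∈-translates⁻ {n} {suc r} y∈ =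
    ℤP.+-mono-≤ (B-nonneg b∈B) (ℤ.+≤+ z≤n)

T⇒Tiling : ∀ {A B} → T α d (interval n) (A , B) → Tiling A B n
T⇒Tiling {n = n} (A-linked , B-linked , _ , A+B=[n] , |[n]|≡ , _ , 0∈B , B-nonneg) = record
  { A-sorted = Linked.Linked⇒AllPairs ℤP.<-trans A-linked
  ; B-sorted = Linked.Linked⇒AllPairs ℤP.<-trans B-linked
  ; sumset   = A+B=[n]
  ; card     = trans (sym (length-interval n)) |[n]|≡
  ; 0∈B      = 0∈B
  ; B-nonneg = B-nonneg _
  }

Tiling⇒T : Tiling A B n → length A * 1 ≡ α → T α 1 (interval n) (A , B)
Tiling⇒T {n = n} t |A|≡α =
  Linked.AllPairs⇒Linked A-sorted , Linked.AllPairs⇒Linked B-sorted , interval-sorted n ,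
  sumset , trans (length-interval n) card , |A|≡α , 0∈B , λ _ → B-nonneg
  where open Tiling t

T-nonempty : ∀ {C A B} → 1 ≤ α → T α d C (A , B) → ∃[ a ] a ∈ A
T-nonempty {A = a ∷ _} _ _ = a , here refl
T-nonempty {A = []} α≥1 (_ , _ , _ , _ , _ , refl , _) with () ← α≥1

T⇒0<n : ∀ {u} → 1 ≤ α → T α d (interval n) u → 0 < n
T⇒0<n α≥1 t with _ , a∈A ← T-nonempty α≥1 t
             with _ , i<n , _ ← ∈-interval⁻ (Tiling.A⊆interval (T⇒Tiling t) a∈A) =
  ℕP.≤-<-trans z≤n i<n

T-B-below : ∀ {u b} → 1 ≤ α → T α d (interval n) u → b ∈ proj₂ u → ∃[ i ] i < n × b ≡ + i
T-B-below α≥1 t b∈B with _ , a∈A ← T-nonempty α≥1 t = Tiling.B-below (T⇒Tiling t) a∈A b∈B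

-- Three embeddings into the tilings of [2h]

Pair : Set
Pair = List ℤ × List ℤ

doubleB : ℕ → Pair → Pair
doubleB h (A , B) = A , translates B h 2

doubleA : ℕ → Pair → Pair
doubleA h (A , B) = translates A h 2 , B

stretch : ℕ → ℕ → Pair → Pair
stretch q L (A , B) = translates A L q , translates B (q * L) q

doubleB-T : ∀ {u} → 1 ≤ α → T α 1 (interval h) u →
            T α 1 (interval (2 * h)) (doubleB h u)
doubleB-T α≥1 t@(_ , _ , _ , _ , _ , |A|≡α , _) with _ , a∈A ← T-nonempty α≥1 t =
  Tiling⇒T (Tiling-translatesʳ 1 (T⇒Tiling t) a∈A) |A|≡α

doubleA-T : ∀ {u} → T α 2 (interval h) u →
            T α 1 (interval (2 * h)) (doubleA h u)
doubleA-T {h = h} {u = A , _} t@(_ , _ , _ , _ , _ , |A|*2≡α , _) =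
  Tiling⇒T (Tiling-translatesˡ 2 (T⇒Tiling t)) (trans (length-translates-*1 A h 2) |A|*2≡α)

stretch-T : ∀ {u} → 1 ≤ α → T α q (interval L) u →
            T α 1 (interval (q * (q * L))) (stretch q L u)
stretch-T {q = zero} {u = A , _} α≥1 (_ , _ , _ , _ , _ , |A|*0≡α , _)
  with () ← subst (1 ≤_) (trans (sym |A|*0≡α) (ℕP.*-zeroʳ (length A))) α≥1
stretch-T {q = suc q} {L} {u = A , _} α≥1 t@(_ , _ , _ , _ , _ , |A|*q≡α , _)
  with _ , a∈A ← T-nonempty α≥1 t =
  Tiling⇒T (Tiling-translatesʳ q (Tiling-translatesˡ (suc q) (T⇒Tiling t)) (∈-++⁺ˡ a∈A))
    (trans (length-translates-*1 A L (suc q)) |A|*q≡α)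

doubleB-injective : ∀ {u v} → doubleB h u ≡ doubleB h v → u ≡ v
doubleB-injective eq =
  cong₂ _,_ (cong proj₁ eq) (translates-injective {r = 2} (s≤s z≤n) (cong proj₂ eq))

doubleA-injective : ∀ {u v} → doubleA h u ≡ doubleA h v → u ≡ v
doubleA-injective eq =
  cong₂ _,_ (translates-injective {r = 2} (s≤s z≤n) (cong proj₁ eq)) (cong proj₂ eq)

stretch-injective : ∀ {u v} → 0 < q → stretch q L u ≡ stretch q L v → u ≡ v
stretch-injective 0<q eq =
  cong₂ _,_ (translates-injective 0<q (cong proj₁ eq)) (translates-injective 0<q (cong proj₂ eq))

-- Disjointness of the images

doubleB-∋ : ∀ h {u} → + 0 ∈ proj₂ u → + h ∈ proj₂ (doubleB h u)
doubleB-∋ h {u} 0∈B =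
  subst (_∈ proj₂ (doubleB h u)) (cong +_ (ℕP.*-identityˡ h))
    (∈-translates⁺ {r = 2} {s = h} (s≤s (s≤s z≤n)) 0∈B)

stretch-∋ : ∀ q L {u} → + 0 ∈ proj₂ u → + (q * (suc q * L)) ∈ proj₂ (stretch (suc q) L u)
stretch-∋ q L 0∈B = ∈-translates⁺ {r = suc q} {s = suc q * L} (ℕP.n<1+n q) 0∈B

div-unique : ∀ {b b′ j j′} → b < n → b′ < n → b + j * n ≡ b′ + j′ * n → j ≡ j′
div-unique {n@(suc _)} {b} {b′} {j} {j′} b<n b′<n eq = begin
  j                 ≡⟨ [b+jn]/n≡j b<n j ⟨
  (b + j * n) / n   ≡⟨ cong (_/ n) eq ⟩
  (b′ + j′ * n) / n ≡⟨ [b+jn]/n≡j b′<n j′ ⟩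
  j′                ∎
  where
  open ≡-Reasoning
  [b+jn]/n≡j : ∀ {b} → b < n → ∀ j → (b + j * n) / n ≡ j
  [b+jn]/n≡j {b} b<n j =
    trans (+-distrib-/-∣ʳ b (divides j refl)) (cong₂ _+_ (m<n⇒m/n≡0 b<n) (m*n/n≡m j n))

double-≢-odd-multiple : ∀ {b j Q} → ¬ 2 ∣ q → 2 * b < Q → 2 * (b + j * Q) ≢ q * Q
double-≢-odd-multiple {q} {b} {j} {Q} q-odd 2b<Q eq =
  q-odd (divides j (sym (div-unique {Q} {2 * b} {0} {j * 2} {q}
    2b<Q (ℕP.≤-<-trans z≤n 2b<Q) (trans (sym (distrib b j Q)) eq))))
  where
  distrib : ∀ b j Q → 2 * (b + j * Q) ≡ 2 * b + j * 2 * Q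
  distrib = solve-∀

multiple-≮-half : ∀ {Q} → 1 ≤ q → 2 * h ≡ suc q * Q → q * Q ≮ h
multiple-≮-half {q} {h} {Q} q≥1 2h≡ qQ<h = ℕP.<⇒≱ 2q<1+q
  (subst (λ t → suc q ≤ q + t) (sym (ℕP.+-identityʳ q)) (ℕP.+-monoˡ-≤ q q≥1))
  where
  2q<1+q : 2 * q < suc q
  2q<1+q = ℕP.*-cancelʳ-< Q (2 * q) (suc q)
    (subst₂ _<_ (sym (ℕP.*-assoc 2 q Q)) 2h≡ (ℕP.*-monoʳ-< 2 qQ<h))

doubleB≢doubleA : ∀ {u v} → 1 ≤ α → T α 1 (interval h) u → T α 2 (interval h) v →
                  doubleB h u ≢ doubleA h v
doubleB≢doubleA {h = h} {u = u} α≥1 tu tv eq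
  with i , i<h , h≡i ← T-B-below α≥1 tv
         (subst (+ h ∈_) (cong proj₂ eq) (doubleB-∋ h {u} (Tiling.0∈B (T⇒Tiling tu))))
  = ℕP.<-irrefl (sym (ℤP.+-injective h≡i)) i<h

stretch≢doubleA : ∀ {u v} → 1 ≤ α → 1 < q → 2 * h ≡ q * (q * L) →
                  T α q (interval L) u → T α 2 (interval h) v → stretch q L u ≢ doubleA h v
stretch≢doubleA {q = suc q} {h} {L} {u} α≥1 (s≤s q≥1) 2h≡ tu tv eq
  with i , i<h , qQ≡i ← T-B-below α≥1 tv
         (subst (+ (q * (suc q * L)) ∈_) (cong proj₂ eq)
           (stretch-∋ q L {u} (Tiling.0∈B (T⇒Tiling tu))))
  = multiple-≮-half q≥1 2h≡ (subst (_< h) (sym (ℤP.+-injective qQ≡i)) i<h)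

stretch≢doubleB : ∀ {u v} → 1 ≤ α → 1 < q → ¬ 2 ∣ q → 2 * h ≡ q * (q * L) →
                  T α q (interval L) u → T α 1 (interval h) v → stretch q L u ≢ doubleB h v
stretch≢doubleB {q = q} {h} {L} {v = v} α≥1 q>1 q-odd 2h≡ tu tv eq
  with j , _ , b , b∈B , h≡b+jQ ← ∈-translates⁻ {q * L} {q}
         (subst (+ h ∈_) (sym (cong proj₂ eq)) (doubleB-∋ h {v} (Tiling.0∈B (T⇒Tiling tv))))
  with i , i<L , refl ← T-B-below α≥1 tu b∈B
  = double-≢-odd-multiple {b = i} {j} q-odd 2i<qL
      (trans (cong (2 *_) (sym (ℤP.+-injective h≡b+jQ))) 2h≡)
  where
  2i<qL : 2 * i < q * L
  2i<qL = ℕP.<-≤-trans (ℕP.*-monoʳ-< 2 i<L) (ℕP.*-monoˡ-≤ L q>1)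

Stretchable : ℕ → ℕ → ℕ → Set
Stretchable q L h = 1 < q × ¬ 2 ∣ q × 2 * h ≡ q * (q * L)

Sources : ℕ → ℕ → ℕ → ℕ → (Pair ⊎ Pair) ⊎ Pair → Set
Sources α q L h = [ [ T α q (interval L) , T α 1 (interval h) ]′ , T α 2 (interval h) ]′

embed : ℕ → ℕ → ℕ → (Pair ⊎ Pair) ⊎ Pair → Pair
embed q L h = [ [ stretch q L , doubleB h ]′ , doubleA h ]′

module _ {α q L h : ℕ} (α≥1 : 1 ≤ α) (stretchable : 0 < L → Stretchable q L h) where

  embed-T : ∀ {x} → Sources α q L h x → T α 1 (interval (2 * h)) (embed q L h x)
  embed-T {inj₁ (inj₁ u)} t with _ , _ , 2h≡ ← stretchable (T⇒0<n α≥1 t) =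
    subst (λ n → T α 1 (interval n) (stretch q L u)) (sym 2h≡) (stretch-T α≥1 t)
  embed-T {inj₁ (inj₂ u)} t = doubleB-T α≥1 t
  embed-T {inj₂ u}        t = doubleA-T t

  embed-injectiveOn : ∀ {x y} → Sources α q L h x → Sources α q L h y →
                      embed q L h x ≡ embed q L h y → x ≡ y
  embed-injectiveOn {inj₁ (inj₁ _)} {inj₁ (inj₁ _)} tu _ eq
    with q>1 , _ ← stretchable (T⇒0<n α≥1 tu) =
    cong (inj₁ ∘ inj₁) (stretch-injective (ℕP.<-trans (s≤s z≤n) q>1) eq)
  embed-injectiveOn {inj₁ (inj₁ _)} {inj₁ (inj₂ _)} tu tv eq
    with q>1 , q-odd , 2h≡ ← stretchable (T⇒0<n α≥1 tu) =
    ⊥-elim (stretch≢doubleB α≥1 q>1 q-odd 2h≡ tu tv eq)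
  embed-injectiveOn {inj₁ (inj₁ _)} {inj₂ _} tu tv eq
    with q>1 , _ , 2h≡ ← stretchable (T⇒0<n α≥1 tu) =
    ⊥-elim (stretch≢doubleA α≥1 q>1 2h≡ tu tv eq)
  embed-injectiveOn {inj₁ (inj₂ _)} {inj₁ (inj₁ _)} tu tv eq
    with q>1 , q-odd , 2h≡ ← stretchable (T⇒0<n α≥1 tv) =
    ⊥-elim (stretch≢doubleB α≥1 q>1 q-odd 2h≡ tv tu (sym eq))
  embed-injectiveOn {inj₁ (inj₂ _)} {inj₁ (inj₂ _)} _ _ eq = cong (inj₁ ∘ inj₂) (doubleB-injective eq)
  embed-injectiveOn {inj₁ (inj₂ _)} {inj₂ _} tu tv eq = ⊥-elim (doubleB≢doubleA α≥1 tu tv eq)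
  embed-injectiveOn {inj₂ _} {inj₁ (inj₁ _)} tu tv eq
    with q>1 , _ , 2h≡ ← stretchable (T⇒0<n α≥1 tv) =
    ⊥-elim (stretch≢doubleA α≥1 q>1 2h≡ tv tu (sym eq))
  embed-injectiveOn {inj₂ _} {inj₁ (inj₂ _)} tu tv eq = ⊥-elim (doubleB≢doubleA α≥1 tv tu (sym eq))
  embed-injectiveOn {inj₂ _} {inj₂ _} _ _ eq = cong inj₂ (doubleA-injective eq)

T-count : ∀ {α q L h nq n₁ n₂ n} → 1 ≤ α → (0 < L → Stretchable q L h) →
          HasCard (T α q (interval L)) nq → HasCard (T α 1 (interval h)) n₁ →
          HasCard (T α 2 (interval h)) n₂ → HasCard (T α 1 (interval (2 * h))) n →
          nq + n₁ + n₂ ≤ n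
T-count {α} {q} {L} {h} α≥1 stretchable tq t₁ t₂ t =
  HasCard-≤ {P = Sources α q L h} (embed q L h)
    (λ {x} → embed-T {h = h} α≥1 stretchable {x}) (embed-injectiveOn {h = h} α≥1 stretchable)
    (HasCard-⊎ (HasCard-⊎ tq t₁) t₂) t

odd-prime : Prime q → 2 < q → ¬ 2 ∣ q
odd-prime q-prime 2<q 2∣q with prime⇒irreducible q-prime 2∣q
... | inj₁ ()
... | inj₂ refl = ℕP.<-irrefl refl 2<q

module _ {p : ℕ → ℕ} (ps : IsPrimeSeq p) where

  private
    p-prime : ∀ i → Prime (p (suc i))
    p-prime = proj₁ ps

    p-increasing : ∀ i → p (suc i) < p (2 + i)
    p-increasing = proj₁ (proj₂ ps)

  p₁<p[2+j] : ∀ j → p 1 < p (2 + j)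
  p₁<p[2+j] zero    = p-increasing 0
  p₁<p[2+j] (suc j) = ℕP.<-trans (p₁<p[2+j] j) (p-increasing (suc j))

  prodSq-stretchable : ∀ k m → 0 < 2 ^ suc k * prodSq p m →
                       Stretchable (p (suc m)) (2 ^ suc k * prodSq p m) (2 ^ k * prodSq p (suc m))
  prodSq-stretchable k zero 0<L = ⊥-elim (ℕP.<-irrefl (sym (ℕP.*-zeroʳ (2 ^ suc k))) 0<L)
  prodSq-stretchable k (suc j) _ =
    1<p , odd-prime (p-prime (suc j)) (ℕP.≤-<-trans 1<p₁ (p₁<p[2+j] j)) ,
    reorder (2 ^ k) (prodSq p (suc j)) (p (2 + j))
    where
    1<p : 1 < p (2 + j)
    1<p = ℕ.nonTrivial⇒n>1 _ {{prime⇒nonTrivial (p-prime (suc j))}}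
    1<p₁ : 1 < p 1
    1<p₁ = ℕ.nonTrivial⇒n>1 _ {{prime⇒nonTrivial (p-prime 0)}}
    reorder : ∀ t P q → 2 * (t * (P * (q * (q * 1)))) ≡ q * (q * (2 * t * P))
    reorder = solve-∀

lemma12 : (p : ℕ → ℕ) → IsPrimeSeq p →
    (α k m : ℕ) → 1 ≤ α → 1 ≤ k → 1 ≤ m →
    (nt ntpm nt1 nt2 : ℕ) →
    HasCard (T α 1 (interval (2 ^ k * prodSq p m))) nt →
    HasCard (T α (p m) (interval (2 ^ k * prodSq p (m ∸ 1)))) ntpm →
    HasCard (T α 1 (interval (2 ^ (k ∸ 1) * prodSq p m))) nt1 →
    HasCard (T α 2 (interval (2 ^ (k ∸ 1) * prodSq p m))) nt2 →
    ntpm + nt1 + nt2 ≤ nt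
lemma12 p ps α (suc k) (suc m) α≥1 _ _ nt _ _ _ t tpm t₁ t₂ =
  T-count α≥1 (prodSq-stretchable ps k m) tpm t₁ t₂
    (subst (λ n → HasCard (T α 1 (interval n)) nt) (ℕP.*-assoc 2 (2 ^ k) (prodSq p (suc m))) t)
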